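{- Consider an instance of Constrained Connectivity-Sum on a graph $G=(V,E)$ whose safe sets are symmetric and hierarchical, and let $OPT$ be an optimal solution (a safely connected subgraph of $G$ with the minimum number of edges). Then every edge $\{x,y\}\in OPT$ is a hard pair.
   Context: Constrained Connectivity: given a graph $G=(V,E)$ and for each pair $(u,v)\in V\times V$ a safe set $S(u,v)\subseteq V$ with $u,v\in S(u,v)$. A subgraph is safely connected if for every pair $(u,v)$ it contains a $u$–$v$ path all of whose vertices lie in $S(u,v)$; Constrained Connectivity-Sum minimizes the number of edges. The safe sets are symmetric if $S(x,y)=S(y,x)$ for all $x,y$, and hierarchical if for all $x,y,z$, $z\in S(x,y)$ implies $S(x,z)\subseteq S(x,y)$ and $S(z,y)\subseteq S(x,y)$. A pair $\{x,y\}$ is easy if there is some $z\in S(x,y)$ with $S(x,z)\subsetneq S(x,y)$ and $S(y,z)\subsetneq S(x,y)$; otherwise it is hard. -}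

module Defs where

open import Data.Nat using (ℕ; _≤_)
open import Data.Bool using (Bool; true; false; if_then_else_; _∧_)
open import Data.Fin using (Fin; _<?_)
open import Data.Fin.Subset using (Subset; _∈_; _⊂_; _⊆_)
open import Data.List using (List; map; allFin)
open import Data.Nat.ListAction using (sum)
open import Data.Product using (Σ; _×_; ∃-syntax)
open import Relation.Nullary using (¬_)
open import Relation.Nullary.Decidable using (⌊_⌋)
open import Relation.Binary.PropositionalEquality using (_≡_)

record Graph (n : ℕ) : Set where
  field
    adj    : Fin n → Fin n → Bool
    sym    : ∀ u v → adj u v ≡ adj v u
    irrefl : ∀ u → adj u u ≡ false
open Graph public

Edge : ∀ {n} → Graph n → Fin n → Fin n → Set
Edge G u v = adj G u v ≡ true

_⊑_ : ∀ {n} → Graph n → Graph n → Set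
H ⊑ G = ∀ u v → Edge H u v → Edge G u v

edgeCount : ∀ {n} → Graph n → ℕ
edgeCount {n} G =
  sum (map (λ i → sum (map (λ j → if ⌊ i <? j ⌋ ∧ adj G i j then 1 else 0)
                           (allFin n)))
           (allFin n))

SafeSets : ℕ → Set
SafeSets n = Fin n → Fin n → Subset n

ValidSafeSets : ∀ {n} → SafeSets n → Set
ValidSafeSets S = ∀ u v → (u ∈ S u v) × (v ∈ S u v)

Symmetric : ∀ {n} → SafeSets n → Set
Symmetric S = ∀ x y → S x y ≡ S y x

Hierarchical : ∀ {n} → SafeSets n → Set
Hierarchical S = ∀ x y z → z ∈ S x y → (S x z ⊆ S x y) × (S z y ⊆ S x y)

-- A walk from u to v in H all of whose vertices lie in the set P.
-- (A walk with all vertices in P exists iff a path with all vertices in P does.)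
data WalkIn {n} (H : Graph n) (P : Subset n) : Fin n → Fin n → Set where
  here : ∀ {u} → u ∈ P → WalkIn H P u u
  step : ∀ {u w v} → u ∈ P → Edge H u w → WalkIn H P w v → WalkIn H P u v

SafelyConnected : ∀ {n} → SafeSets n → Graph n → Set
SafelyConnected S H = ∀ u v → WalkIn H (S u v) u v

Optimal : ∀ {n} → Graph n → SafeSets n → Graph n → Set
Optimal G S OPT =
  OPT ⊑ G × SafelyConnected S OPT ×
  (∀ (H : Graph n) → H ⊑ G → SafelyConnected S H → edgeCount OPT ≤ edgeCount H)
  where n = _

Easy : ∀ {n} → SafeSets n → Fin n → Fin n → Set
Easy S x y = ∃[ z ] (z ∈ S x y × S x z ⊂ S x y × S y z ⊂ S x y)

Hard : ∀ {n} → SafeSets n → Fin n → Fin n → Set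
Hard S x y = ¬ Easy S x y

{-# OPTIONS --safe #-}
-- If the edge {x,y} of an optimal solution were easy, with witness z, then
-- the S(x,z)-safe x–z path avoids y and the S(z,y)-safe z–y path avoids x
-- (by hierarchy, containing the other endpoint would force S(x,y) inside
-- the strictly smaller set).  Together they bypass {x,y} inside S(x,y).
-- Deleting the edge keeps the solution safely connected: a safe u–v path
-- through {x,y} lies in S(u,v) ⊇ S(x,y), so it can take the bypass, unless
-- S(x,y) ⊈ S(u,v); then y ∈ S(u,v) splits the path at y into an S(u,y)- and
-- an S(y,v)-safe part, neither of which can contain x.  This contradicts
-- minimality.
module Submission where

open import Defs
open import Data.Nat using (ℕ; _≤_; _<_; z≤n; s≤s)
open import Data.Nat.Properties using (+-mono-≤; +-mono-<-≤; +-mono-≤-<; <⇒≱)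
open import Data.Nat.ListAction using (sum)
open import Data.Bool using (Bool; true; false; if_then_else_; _∧_; _∨_; not)
open import Data.Bool.Properties using (∧-comm; ∨-comm; ∧-zeroʳ)
open import Data.Fin using (Fin; _<?_; _≟_) renaming (_<_ to _<ᶠ_)
open import Data.Fin.Properties using (<-cmp)
open import Data.Fin.Subset using (Subset; _∈_; _∉_; _⊆_; _⊂_)
open import Data.Fin.Subset.Properties using (_∈?_; _⊆?_; ⊆-trans; ⊆-reflexive)
open import Data.List using (List; []; _∷_; map; allFin)
open import Data.List.Relation.Unary.Any using (here; there)
import Data.List.Membership.Propositional as List
open import Data.List.Membership.Propositional.Properties using (∈-allFin)
open import Data.Product using (_×_; _,_; proj₁; proj₂)
open import Data.Sum using (_⊎_; inj₁; inj₂)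
open import Data.Empty using (⊥-elim)
open import Function using (_∘_)
open import Relation.Nullary using (¬_; yes; no)
open import Relation.Nullary.Decidable using (⌊_⌋)
open import Relation.Binary.PropositionalEquality
  using (_≡_; refl; trans; cong; cong₂) renaming (sym to ≡-sym)
open import Relation.Binary.Definitions using (tri<; tri≈; tri>)

sum-map-≤ : ∀ {A : Set} {f g : A → ℕ} (xs : List A) →
            (∀ a → f a ≤ g a) → sum (map f xs) ≤ sum (map g xs)
sum-map-≤ []       f≤g = z≤n
sum-map-≤ (a ∷ xs) f≤g = +-mono-≤ (f≤g a) (sum-map-≤ xs f≤g)

sum-map-< : ∀ {A : Set} {f g : A → ℕ} {xs : List A} {a} →
            (∀ b → f b ≤ g b) → a List.∈ xs → f a < g a →
            sum (map f xs) < sum (map g xs)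
sum-map-< {xs = _ ∷ xs} f≤g (here refl) fa<ga = +-mono-<-≤ fa<ga (sum-map-≤ xs f≤g)
sum-map-< {xs = b ∷ _}  f≤g (there a∈) fa<ga = +-mono-≤-< (f≤g b) (sum-map-< f≤g a∈ fa<ga)

⊂⇒⊉ : ∀ {n} {A B : Subset n} → A ⊂ B → ¬ (B ⊆ A)
⊂⇒⊉ (_ , _ , b∈B , b∉A) B⊆A = b∉A (B⊆A b∈B)

Edge-sym : ∀ {n} (G : Graph n) {u v} → Edge G u v → Edge G v u
Edge-sym G {u} {v} e = trans (sym G v u) e

¬Edge-refl : ∀ {n} (G : Graph n) {u} → ¬ Edge G u u
¬Edge-refl G {u} e with () ← trans (≡-sym (irrefl G u)) e

-- edgeCount G is, definitionally, the double sum of edgeIndicator G over allFin n.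
edgeIndicator : ∀ {n} → Graph n → Fin n → Fin n → ℕ
edgeIndicator G i j = if ⌊ i <? j ⌋ ∧ adj G i j then 1 else 0

edgeIndicator-mono : ∀ {n} {H G : Graph n} → H ⊑ G →
                     ∀ i j → edgeIndicator H i j ≤ edgeIndicator G i j
edgeIndicator-mono {H = H} H⊑G i j with ⌊ i <? j ⌋ | adj H i j in e
... | false | _     = z≤n
... | true  | false = z≤n
... | true  | true  rewrite H⊑G i j e = s≤s z≤n

edgeIndicator-< : ∀ {n} {H G : Graph n} {i j} → i <ᶠ j →
                  Edge G i j → ¬ Edge H i j →
                  edgeIndicator H i j < edgeIndicator G i j
edgeIndicator-< {H = H} {i = i} {j} i<j eG ¬eH with i <? j | adj H i j
... | no i≮j | _     = ⊥-elim (i≮j i<j)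
... | yes _  | true  = ⊥-elim (¬eH refl)
... | yes _  | false rewrite eG = s≤s z≤n

edgeCount-<-ordered : ∀ {n} {H G : Graph n} {i j} → H ⊑ G → i <ᶠ j →
                      Edge G i j → ¬ Edge H i j → edgeCount H < edgeCount G
edgeCount-<-ordered {H = H} {G} {i} {j} H⊑G i<j eG ¬eH =
  sum-map-< (λ k → sum-map-≤ (allFin _) (indicator≤ k)) (∈-allFin i)
    (sum-map-< (indicator≤ i) (∈-allFin j) (edgeIndicator-< {H = H} {G} i<j eG ¬eH))
  where
  indicator≤ : ∀ k l → edgeIndicator H k l ≤ edgeIndicator G k l
  indicator≤ = edgeIndicator-mono {H = H} {G} H⊑G

edgeCount-< : ∀ {n} {H G : Graph n} {x y} → H ⊑ G →
              Edge G x y → ¬ Edge H x y → edgeCount H < edgeCount G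
edgeCount-< {H = H} {G} {x} {y} H⊑G eG ¬eH with <-cmp x y
... | tri< x<y _ _  = edgeCount-<-ordered {H = H} {G} H⊑G x<y eG ¬eH
... | tri≈ _ refl _ = ⊥-elim (¬Edge-refl G eG)
... | tri> _ _ y<x  = edgeCount-<-ordered {H = H} {G} H⊑G y<x (Edge-sym G eG) (¬eH ∘ Edge-sym H)

isPair : ∀ {n} → Fin n → Fin n → Fin n → Fin n → Bool
isPair x y i j = (⌊ i ≟ x ⌋ ∧ ⌊ j ≟ y ⌋) ∨ (⌊ i ≟ y ⌋ ∧ ⌊ j ≟ x ⌋)

isPair-sym : ∀ {n} (x y i j : Fin n) → isPair x y i j ≡ isPair x y j i
isPair-sym x y i j =
  trans (∨-comm (⌊ i ≟ x ⌋ ∧ ⌊ j ≟ y ⌋) _)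
        (cong₂ _∨_ (∧-comm ⌊ i ≟ y ⌋ _) (∧-comm ⌊ i ≟ x ⌋ _))

isPair-cases : ∀ {n} (x y i j : Fin n) →
               isPair x y i j ≡ false ⊎ (i ≡ x × j ≡ y) ⊎ (i ≡ y × j ≡ x)
isPair-cases x y i j with i ≟ x | j ≟ y | i ≟ y | j ≟ x
... | yes i≡x | yes j≡y | _       | _       = inj₂ (inj₁ (i≡x , j≡y))
... | _       | _       | yes i≡y | yes j≡x = inj₂ (inj₂ (i≡y , j≡x))
... | no _    | _       | no _    | _       = inj₁ refl
... | no _    | _       | yes _   | no _    = inj₁ refl
... | yes _   | no _    | no _    | _       = inj₁ refl
... | yes _   | no _    | yes _   | no _    = inj₁ refl

isPair-refl : ∀ {n} (x y : Fin n) → isPair x y x y ≡ true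
isPair-refl x y with x ≟ x | y ≟ y
... | yes _   | yes _   = refl
... | no x≢x  | _       = ⊥-elim (x≢x refl)
... | yes _   | no y≢y  = ⊥-elim (y≢y refl)

deleteEdge : ∀ {n} → Graph n → Fin n → Fin n → Graph n
deleteEdge G x y = record
  { adj    = λ i j → not (isPair x y i j) ∧ adj G i j
  ; sym    = λ i j → cong₂ (λ p a → not p ∧ a) (isPair-sym x y i j) (sym G i j)
  ; irrefl = λ i → trans (cong (not (isPair x y i i) ∧_) (irrefl G i)) (∧-zeroʳ _)
  }

deleteEdge-⊑ : ∀ {n} (G : Graph n) x y → deleteEdge G x y ⊑ G
deleteEdge-⊑ G x y u v e with not (isPair x y u v)
... | true = e

deleteEdge-removes : ∀ {n} (G : Graph n) x y → ¬ Edge (deleteEdge G x y) x y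
deleteEdge-removes G x y e
  with () ← trans (cong (λ p → not p ∧ adj G x y) (≡-sym (isPair-refl x y))) e

edgeCount-deleteEdge : ∀ {n} (G : Graph n) {x y} → Edge G x y →
                       edgeCount (deleteEdge G x y) < edgeCount G
edgeCount-deleteEdge G {x} {y} xy =
  edgeCount-< {H = deleteEdge G x y} {G} (deleteEdge-⊑ G x y) xy (deleteEdge-removes G x y)

deleteEdge-keeps : ∀ {n} (G : Graph n) {x y u v} → isPair x y u v ≡ false →
                   Edge G u v → Edge (deleteEdge G x y) u v
deleteEdge-keeps G other e rewrite other = e

module _ {n} {G : Graph n} {P : Subset n} where

  WalkIn-head : ∀ {a b} → WalkIn G P a b → a ∈ P
  WalkIn-head (here a∈P)     = a∈P
  WalkIn-head (step a∈P _ _) = a∈P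

  infixr 5 _++ʷ_
  _++ʷ_ : ∀ {a b c} → WalkIn G P a b → WalkIn G P b c → WalkIn G P a c
  here _       ++ʷ q = q
  step a∈P e p ++ʷ q = step a∈P e (p ++ʷ q)

  WalkIn-reverse : ∀ {a b} → WalkIn G P a b → WalkIn G P b a
  WalkIn-reverse (here a∈P)     = here a∈P
  WalkIn-reverse (step a∈P e p) =
    WalkIn-reverse p ++ʷ step (WalkIn-head p) (Edge-sym G e) (here a∈P)

WalkIn-mono : ∀ {n} {G : Graph n} {P Q : Subset n} {a b} →
              P ⊆ Q → WalkIn G P a b → WalkIn G Q a b
WalkIn-mono P⊆Q (here a∈P)     = here (P⊆Q a∈P)
WalkIn-mono P⊆Q (step a∈P e p) = step (P⊆Q a∈P) e (WalkIn-mono P⊆Q p)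

module _ {n} {G : Graph n} {x y : Fin n} {P : Subset n} where

  reroute : (x ∈ P → y ∈ P → WalkIn (deleteEdge G x y) P x y) →
            ∀ {a b} → WalkIn G P a b → WalkIn (deleteEdge G x y) P a b
  reroute bypass (here a∈P) = here a∈P
  reroute bypass (step {u} {w} u∈P e p) with isPair-cases x y u w
  ... | inj₁ other                = step u∈P (deleteEdge-keeps G other e) (reroute bypass p)
  ... | inj₂ (inj₁ (refl , refl)) = bypass u∈P (WalkIn-head p) ++ʷ reroute bypass p
  ... | inj₂ (inj₂ (refl , refl)) =
    WalkIn-reverse (bypass (WalkIn-head p) u∈P) ++ʷ reroute bypass p

  reroute-∉ˡ : x ∉ P → ∀ {a b} → WalkIn G P a b → WalkIn (deleteEdge G x y) P a b
  reroute-∉ˡ x∉P = reroute (λ x∈P _ → ⊥-elim (x∉P x∈P))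

  reroute-∉ʳ : y ∉ P → ∀ {a b} → WalkIn G P a b → WalkIn (deleteEdge G x y) P a b
  reroute-∉ʳ y∉P = reroute (λ _ y∈P → ⊥-elim (y∉P y∈P))

module _ {n} {S : SafeSets n} (symm : Symmetric S) (hier : Hierarchical S)
         {G : Graph n} (conn : SafelyConnected S G) {x y : Fin n} where

  easy⇒bypass : Easy S x y → WalkIn (deleteEdge G x y) (S x y) x y
  easy⇒bypass (z , _ , Sxz⊂Sxy , Syz⊂Sxy) =
    WalkIn-mono (proj₁ Sxz⊂Sxy) (reroute-∉ʳ y∉Sxz (conn x z))
    ++ʷ WalkIn-mono Szy⊆Sxy (reroute-∉ˡ x∉Szy (conn z y))
    where
    Szy⊆Syz : S z y ⊆ S y z
    Szy⊆Syz = ⊆-reflexive (symm z y)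
    Szy⊆Sxy : S z y ⊆ S x y
    Szy⊆Sxy = ⊆-trans Szy⊆Syz (proj₁ Syz⊂Sxy)
    y∉Sxz : y ∉ S x z
    y∉Sxz y∈ = ⊂⇒⊉ Sxz⊂Sxy (proj₁ (hier x z y y∈))
    x∉Szy : x ∉ S z y
    x∉Szy x∈ = ⊂⇒⊉ Syz⊂Sxy (⊆-trans (proj₂ (hier z y x x∈)) Szy⊆Syz)

  deleteEdge-safelyConnected : WalkIn (deleteEdge G x y) (S x y) x y →
                               SafelyConnected S (deleteEdge G x y)
  deleteEdge-safelyConnected bypass u v with y ∈? S u v
  ... | no y∉Suv = reroute-∉ʳ y∉Suv (conn u v)
  ... | yes y∈Suv with S x y ⊆? S u v
  ...   | yes Sxy⊆Suv = reroute (λ _ _ → WalkIn-mono Sxy⊆Suv bypass) (conn u v)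
  ...   | no Sxy⊈Suv  =
    WalkIn-mono Suy⊆Suv (reroute-∉ˡ x∉Suy (conn u y))
    ++ʷ WalkIn-mono Syv⊆Suv (reroute-∉ˡ x∉Syv (conn y v))
    where
    Suy⊆Suv : S u y ⊆ S u v
    Suy⊆Suv = proj₁ (hier u v y y∈Suv)
    Syv⊆Suv : S y v ⊆ S u v
    Syv⊆Suv = proj₂ (hier u v y y∈Suv)
    x∉Suy : x ∉ S u y
    x∉Suy x∈ = Sxy⊈Suv (⊆-trans (proj₂ (hier u y x x∈)) Suy⊆Suv)
    x∉Syv : x ∉ S y v
    x∉Syv x∈ = Sxy⊈Suv
      (⊆-trans (⊆-reflexive (symm x y)) (⊆-trans (proj₁ (hier y v x x∈)) Syv⊆Suv))

lemma25 : ∀ {n : ℕ} (G : Graph n) (S : SafeSets n) → ValidSafeSets S → Symmetric S → Hierarchical S → (OPT : Graph n) → Optimal G S OPT → ∀ (x y : Fin n) → Edge OPT x y → Hard S x y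
lemma25 G S _ symm hier OPT (OPT⊑G , conn , minimal) x y xy easy =
  <⇒≱ (edgeCount-deleteEdge OPT xy) (minimal (deleteEdge OPT x y) ⊑G safelyConnected)
  where
  ⊑G : deleteEdge OPT x y ⊑ G
  ⊑G u v = OPT⊑G u v ∘ deleteEdge-⊑ OPT x y u v
  safelyConnected : SafelyConnected S (deleteEdge OPT x y)
  safelyConnected =
    deleteEdge-safelyConnected symm hier conn (easy⇒bypass symm hier conn easy)
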